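{- For generic $k,q$ (no denominators vanishing), the pair defined by $\bm\alpha_0=1$, $\bm\alpha_n=(-1)^nq^{ -n^2/2}\left(q^{ -3n/2}+q^{3n/2}\right)$ for $n\ge1$, and \[ \bm\beta_n=\frac{(-1)^n(1-kq^n+kq^{2n})(k;q)_n}{q^{(n^2+3n)/2}(q;q)_n}\quad(n\ge0) \] is a WP-Bailey pair relative to $a=1$ and $k$.
   Context: For $n\ge0$, $(x;q)_n=\prod_{i=0}^{n-1}(1-xq^i)$ and $(x_1,\dots,x_j;q)_n=(x_1;q)_n\cdots(x_j;q)_n$. A pair of sequences $(\bm\alpha_n,\bm\beta_n)_{n\ge0}$ is a WP-Bailey pair relative to $a,k$ (base $q$) if $\bm\alpha_0=1$ and for all $n\ge0$, $\bm\beta_n=\sum_{j=0}^{n}\frac{(k/a;q)_{n-j}(k;q)_{n+j}}{(q;q)_{n-j}(aq;q)_{n+j}}\bm\alpha_j$. -}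

module Defs where

open import Level using (Level; _⊔_) renaming (suc to lsuc)
open import Data.Nat using (ℕ; zero; suc) renaming (_+_ to _+ℕ_; _∸_ to _∸ℕ_)
open import Relation.Nullary using (¬_)
open import Algebra.Bundles using (CommutativeRing)
open import Data.Product using (_×_)

-- A field: a commutative ring with 0 ≠ 1 and a (total) inverse map that is a
-- genuine multiplicative inverse on every nonzero element (the value at 0 is
-- irrelevant; it is never used under the hypotheses of the theorem).
record Field (c ℓ : Level) : Set (lsuc (c ⊔ ℓ)) where
  field
    commutativeRing : CommutativeRing c ℓ
  open CommutativeRing commutativeRing public
  infix 8 _⁻¹
  field
    _⁻¹       : Carrier → Carrier
    ⁻¹-cong   : ∀ {x y} → x ≈ y → x ⁻¹ ≈ y ⁻¹
    inverseʳ  : ∀ x → ¬ (x ≈ 0#) → x * x ⁻¹ ≈ 1#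
    0≉1       : ¬ (0# ≈ 1#)

module FieldDefs {c ℓ : Level} (F : Field c ℓ) where
  open Field F using (Carrier; _≈_; _+_; _*_; -_; _-_; 0#; 1#; _⁻¹)

  pow : Carrier → ℕ → Carrier
  pow x zero    = 1#
  pow x (suc n) = x * pow x n

  sgn : ℕ → Carrier
  sgn n = pow (- 1#) n

  _÷_ : Carrier → Carrier → Carrier
  x ÷ y = x * y ⁻¹

  poch : Carrier → Carrier → ℕ → Carrier
  poch x q zero    = 1#
  poch x q (suc n) = poch x q n * (1# - x * pow q n)

  sumTo : ℕ → (ℕ → Carrier) → Carrier
  sumTo zero    f = f zero
  sumTo (suc n) f = sumTo n f + f (suc n)

  IsWPBaileyPair : (q a k : Carrier) → (α β : ℕ → Carrier) → Set ℓ
  IsWPBaileyPair q a k α β =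
    (α 0 ≈ 1#) × (∀ n → β n ≈ sumTo n (λ j →
        ((poch (k ÷ a) q (n ∸ℕ j) * poch k q (n +ℕ j))
          ÷ (poch q q (n ∸ℕ j) * poch (a * q) q (n +ℕ j))) * α j))

-- The pair of Theorem 13.  The half-integer powers of q are expressed through
-- a chosen square root s of q (q = s * s, q^{m/2} = s^m).
module Pair13 {c ℓ : Level} (F : Field c ℓ) where
  open Field F using (Carrier; _+_; _*_; _-_; 0#; 1#; _⁻¹)
  open FieldDefs F
  open import Data.Nat using () renaming (_*_ to _*ℕ_)

  α13 : (s : Carrier) → ℕ → Carrier
  α13 s zero = 1#
  α13 s (suc m) = let n = suc m in
    sgn n * pow (s ⁻¹) (n *ℕ n) * (pow (s ⁻¹) (3 *ℕ n) + pow s (3 *ℕ n))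

  β13 : (k s : Carrier) → ℕ → Carrier
  β13 k s n = let q = s * s in
    (sgn n * (1# - k * pow q n + k * pow q (2 *ℕ n)) * poch k q n)
      ÷ (pow s (n *ℕ n +ℕ 3 *ℕ n) * poch q q n)

{-# OPTIONS --safe #-}
module Submission where

-- With A m = (k;q)_m / (q;q)_m the WP-Bailey coefficient for a = 1 is K n j = A (n − j) A (n + j).
-- Put f m = (−1)^m q^{−(m²+m)/2}, so that α_j = f j (q^{−j} + q^{2j}) for j ≥ 1, and compare with the
-- simpler pair α₁ j = f j (1 + q^j) (α₁ 0 = 1), β₁ n = A n f n. Creative telescoping in j gives
--   q^n Σ_j K n j α_j = (1 − k q^n + k q^{2n}) Σ_j K n j α₁ j                  (certificate GA),
--   c₁ n Σ_j K (n+1) j α₁ j + c₀ n Σ_j K n j α₁ j = 0                          (certificate GB),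
-- where c₁ n = (1 − q^{n+1}) q^{n+1} and c₀ n = 1 − k q^n. Since β₁ satisfies the same first-order
-- recurrence and agrees at n = 0, Σ_j K n j α₁ j = β₁ n, and q^{−n} (1 − k q^n + k q^{2n}) β₁ n = β_n.
-- Each telescoping step reduces, via A (m+1) (1 − q^{m+1}) = A m (1 − k q^m) and f m = −q^{m+1} f (m+1),
-- to a polynomial identity in q, k, q^{n−j} and q^j.

open import Defs
open import Level using (Level)
open import Algebra.Bundles using (CommutativeRing; RawRing)
import Algebra.Solver.Ring
import Algebra.Solver.Ring.AlmostCommutativeRing as ACR
open import Data.Maybe using (Maybe; just; nothing)
open import Data.Nat as ℕ using (ℕ; zero; suc; _∸_; _≤_; z≤n)
import Data.Nat.Properties as ℕ
open import Data.Nat.Tactic.RingSolver using (solve-∀)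
open import Data.Product using (_×_; _,_)
open import Data.Product.Properties using (≡-dec)
open import Relation.Binary.PropositionalEquality as ≡ using (_≡_)
open import Relation.Nullary using (¬_; yes; no)

3*m≡m+[m+m] : ∀ m → 3 ℕ.* m ≡ m ℕ.+ (m ℕ.+ m)
3*m≡m+[m+m] = solve-∀

m*m+3*m≡[m*m+m]+[m+m] : ∀ m → m ℕ.* m ℕ.+ 3 ℕ.* m ≡ (m ℕ.* m ℕ.+ m) ℕ.+ (m ℕ.+ m)
m*m+3*m≡[m*m+m]+[m+m] = solve-∀

[1+m]*[1+m]+[1+m]≡[m*m+m]+[[1+m]+[1+m]] : ∀ m →
  suc m ℕ.* suc m ℕ.+ suc m ≡ (m ℕ.* m ℕ.+ m) ℕ.+ (suc m ℕ.+ suc m)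
[1+m]*[1+m]+[1+m]≡[m*m+m]+[[1+m]+[1+m]] = solve-∀

-- The library's ring solvers for an abstract commutative ring either have natural-number
-- coefficients or need a decidable equality on the carrier, so Algebra.Solver.Ring is
-- instantiated here with integer coefficients.
module IntegerCoefficientRingSolver {c ℓ : Level} (R : CommutativeRing c ℓ) where
  open CommutativeRing R
  open import Relation.Binary.Reasoning.Setoid setoid
  open import Algebra.Properties.Semiring.Mult.TCOptimised semiring using (×-homo-+; ×1-homo-*) renaming (_×_ to _×′_)
  open import Algebra.Properties.AbelianGroup +-abelianGroup using (⁻¹-anti-homo‿-; ⁻¹-∙-comm)
  open import Algebra.Properties.Group +-group using (quasigroup; //-rightDividesˡ)
  open import Algebra.Properties.Quasigroup quasigroup using (x≈z//y)
  import Algebra.Solver.Ring.NaturalCoefficients.Default commutativeSemiring as ℕS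

  ι : ℕ → Carrier
  ι n = n ×′ 1#

  -- (a , b) stands for the integer a - b.
  Difference : Set
  Difference = ℕ × ℕ

  normalise : ℕ → ℕ → Difference
  normalise a b = (a ∸ b , b ∸ a)

  _⊕_ _⊛_ : Difference → Difference → Difference
  (a , b) ⊕ (c , d) = normalise (a ℕ.+ c) (b ℕ.+ d)
  (a , b) ⊛ (c , d) = normalise (a ℕ.* c ℕ.+ b ℕ.* d) (a ℕ.* d ℕ.+ b ℕ.* c)

  ⊝_ : Difference → Difference
  ⊝ (a , b) = (b , a)

  differenceRing : RawRing Level.zero Level.zero
  differenceRing = record
    { Carrier = Difference ; _≈_ = _≡_ ; _+_ = _⊕_ ; _*_ = _⊛_ ; -_ = ⊝_ ; 0# = (0 , 0) ; 1# = (1 , 0) }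

  -- No "- 0#" on nonnegative values: the constants :0 and :1 then denote 0# and 1# definitionally.
  ⟦_⟧ : Difference → Carrier
  ⟦ (a , zero) ⟧  = ι a
  ⟦ (a , suc b) ⟧ = ι a - ι (suc b)

  ⟦⟧-≈ : ∀ a b → ⟦ (a , b) ⟧ ≈ ι a - ι b
  ⟦⟧-≈ a zero    = x≈z//y (ι a) 0# (ι a) (+-identityʳ (ι a))
  ⟦⟧-≈ a (suc b) = refl

  sub-cong : ∀ {x y x' y'} → x + y' ≈ x' + y → x - y ≈ x' - y'
  sub-cong {x} {y} {x'} {y'} eq = x≈z//y (x - y) y' x' (begin
    (x - y) + y'   ≈⟨ ℕS.solve 3 (λ x y y' → (x ℕS.:+ y) ℕS.:+ y' ℕS.:= (x ℕS.:+ y') ℕS.:+ y) refl x (- y) y' ⟩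
    (x + y') - y   ≈⟨ +-congʳ eq ⟩
    (x' + y) - y   ≈⟨ +-assoc x' y (- y) ⟩
    x' + (y - y)   ≈⟨ +-congˡ (-‿inverseʳ y) ⟩
    x' + 0#        ≈⟨ +-identityʳ x' ⟩
    x'             ∎)

  ⟦normalise⟧ : ∀ a b → ⟦ normalise a b ⟧ ≈ ι a - ι b
  ⟦normalise⟧ zero    zero    = ⟦⟧-≈ 0 0
  ⟦normalise⟧ zero    (suc b) = refl
  ⟦normalise⟧ (suc a) zero    = ⟦⟧-≈ (suc a) 0
  ⟦normalise⟧ (suc a) (suc b) = trans (⟦normalise⟧ a b) (sub-cong (begin
    ι a + ι (suc b)    ≈⟨ ×-homo-+ 1# a (suc b) ⟨
    ι (a ℕ.+ suc b)    ≡⟨ ≡.cong ι (ℕ.+-suc a b) ⟩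
    ι (suc a ℕ.+ b)    ≈⟨ ×-homo-+ 1# (suc a) b ⟩
    ι (suc a) + ι b    ∎))

  +-homo : ∀ x y → ⟦ x ⊕ y ⟧ ≈ ⟦ x ⟧ + ⟦ y ⟧
  +-homo (a , b) (c , d) = begin
    ⟦ normalise (a ℕ.+ c) (b ℕ.+ d) ⟧  ≈⟨ ⟦normalise⟧ (a ℕ.+ c) (b ℕ.+ d) ⟩
    ι (a ℕ.+ c) - ι (b ℕ.+ d)         ≈⟨ +-cong (×-homo-+ 1# a c) (-‿cong (×-homo-+ 1# b d)) ⟩
    (ι a + ι c) - (ι b + ι d)         ≈⟨ +-congˡ (⁻¹-∙-comm (ι b) (ι d)) ⟨
    (ι a + ι c) + (- ι b - ι d)       ≈⟨ ℕS.solve 4 (λ a c b d → (a ℕS.:+ c) ℕS.:+ (b ℕS.:+ d) ℕS.:= (a ℕS.:+ b) ℕS.:+ (c ℕS.:+ d)) refl (ι a) (ι c) (- ι b) (- ι d) ⟩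
    (ι a - ι b) + (ι c - ι d)         ≈⟨ +-cong (⟦⟧-≈ a b) (⟦⟧-≈ c d) ⟨
    ⟦ (a , b) ⟧ + ⟦ (c , d) ⟧          ∎

  *-homo : ∀ x y → ⟦ x ⊛ y ⟧ ≈ ⟦ x ⟧ * ⟦ y ⟧
  *-homo (a , b) (c , d) = begin
    ⟦ normalise (a ℕ.* c ℕ.+ b ℕ.* d) (a ℕ.* d ℕ.+ b ℕ.* c) ⟧
      ≈⟨ ⟦normalise⟧ (a ℕ.* c ℕ.+ b ℕ.* d) (a ℕ.* d ℕ.+ b ℕ.* c) ⟩
    ι (a ℕ.* c ℕ.+ b ℕ.* d) - ι (a ℕ.* d ℕ.+ b ℕ.* c)
      ≈⟨ +-cong (ι-+-* a c b d) (-‿cong (ι-+-* a d b c)) ⟩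
    (A * C + B * D) - (A * D + B * C)
      ≈⟨ x≈z//y ((A - B) * (C - D)) (A * D + B * C) (A * C + B * D) expand ⟨
    (A - B) * (C - D)
      ≈⟨ *-cong (⟦⟧-≈ a b) (⟦⟧-≈ c d) ⟨
    ⟦ (a , b) ⟧ * ⟦ (c , d) ⟧ ∎
    where
    A = ι a ; B = ι b ; C = ι c ; D = ι d
    u = A - B ; v = C - D
    expand : u * v + (A * D + B * C) ≈ A * C + B * D
    expand = begin
      u * v + (A * D + B * C)              ≈⟨ +-congˡ (+-cong (*-congʳ A≈) (*-congˡ C≈)) ⟩
      u * v + ((u + B) * D + B * (v + D))  ≈⟨ ℕS.solve 4 (λ u v B D → u ℕS.:* v ℕS.:+ ((u ℕS.:+ B) ℕS.:* D ℕS.:+ B ℕS.:* (v ℕS.:+ D)) ℕS.:= (u ℕS.:+ B) ℕS.:* (v ℕS.:+ D) ℕS.:+ B ℕS.:* D) refl u v B D ⟩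
      (u + B) * (v + D) + B * D            ≈⟨ +-congʳ (*-cong A≈ C≈) ⟨
      A * C + B * D                        ∎
      where
      A≈ : A ≈ u + B
      A≈ = sym (//-rightDividesˡ B A)
      C≈ : C ≈ v + D
      C≈ = sym (//-rightDividesˡ D C)
    ι-+-* : ∀ a c b d → ι (a ℕ.* c ℕ.+ b ℕ.* d) ≈ ι a * ι c + ι b * ι d
    ι-+-* a c b d = trans (×-homo-+ 1# (a ℕ.* c) (b ℕ.* d)) (+-cong (×1-homo-* a c) (×1-homo-* b d))

  -‿homo : ∀ x → ⟦ ⊝ x ⟧ ≈ - ⟦ x ⟧
  -‿homo (a , b) = begin
    ⟦ (b , a) ⟧     ≈⟨ ⟦⟧-≈ b a ⟩
    ι b - ι a       ≈⟨ ⁻¹-anti-homo‿- (ι a) (ι b) ⟨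
    - (ι a - ι b)   ≈⟨ -‿cong (⟦⟧-≈ a b) ⟨
    - ⟦ (a , b) ⟧   ∎

  morphism : differenceRing ACR.-Raw-AlmostCommutative⟶ ACR.fromCommutativeRing R
  morphism = record
    { ⟦_⟧ = ⟦_⟧ ; +-homo = +-homo ; *-homo = *-homo ; -‿homo = -‿homo ; 0-homo = refl ; 1-homo = refl }

  _≟-Difference_ : ∀ x y → Maybe (⟦ x ⟧ ≈ ⟦ y ⟧)
  x ≟-Difference y with ≡-dec ℕ._≟_ ℕ._≟_ x y
  ... | yes ≡.refl = just refl
  ... | no _       = nothing

  open Algebra.Solver.Ring differenceRing (ACR.fromCommutativeRing R) morphism _≟-Difference_ public
    using (Polynomial; con; _:+_; _:*_; :-_; _:-_; _:=_; solve)

  :0 :1 : ∀ {n} → Polynomial n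
  :0 = con (0 , 0)
  :1 = con (1 , 0)


module FieldProperties {c ℓ : Level} (F : Field c ℓ) where
  open Field F
  open FieldDefs F
  open IntegerCoefficientRingSolver commutativeRing
  open import Relation.Binary.Reasoning.Setoid setoid

  1≉0 : ¬ (1# ≈ 0#)
  1≉0 1≈0 = 0≉1 (sym 1≈0)

  inverseˡ : ∀ x → ¬ (x ≈ 0#) → x ⁻¹ * x ≈ 1#
  inverseˡ x x≉0 = trans (*-comm (x ⁻¹) x) (inverseʳ x x≉0)

  *-cancelˡ : ∀ {x y z} → ¬ (x ≈ 0#) → x * y ≈ x * z → y ≈ z
  *-cancelˡ {x} {y} {z} x≉0 xy≈xz = begin
    y                 ≈⟨ *-identityˡ y ⟨
    1# * y            ≈⟨ *-congʳ (inverseˡ x x≉0) ⟨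
    (x ⁻¹ * x) * y    ≈⟨ *-assoc (x ⁻¹) x y ⟩
    x ⁻¹ * (x * y)    ≈⟨ *-congˡ xy≈xz ⟩
    x ⁻¹ * (x * z)    ≈⟨ *-assoc (x ⁻¹) x z ⟨
    (x ⁻¹ * x) * z    ≈⟨ *-congʳ (inverseˡ x x≉0) ⟩
    1# * z            ≈⟨ *-identityˡ z ⟩
    z                 ∎

  ⁻¹-unique : ∀ {x y} → ¬ (x ≈ 0#) → x * y ≈ 1# → y ≈ x ⁻¹
  ⁻¹-unique {x} {y} x≉0 xy≈1 = *-cancelˡ x≉0 (trans xy≈1 (sym (inverseʳ x x≉0)))

  *-nonzero : ∀ {x y} → ¬ (x ≈ 0#) → ¬ (y ≈ 0#) → ¬ (x * y ≈ 0#)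
  *-nonzero {x} {y} x≉0 y≉0 xy≈0 = y≉0 (*-cancelˡ x≉0 (trans xy≈0 (sym (zeroʳ x))))

  nonzero-factorʳ : ∀ {x y} → ¬ (x * y ≈ 0#) → ¬ (y ≈ 0#)
  nonzero-factorʳ {x} xy≉0 y≈0 = xy≉0 (trans (*-congˡ y≈0) (zeroʳ x))

  ⁻¹-distrib-* : ∀ {x y} → ¬ (x ≈ 0#) → ¬ (y ≈ 0#) → (x * y) ⁻¹ ≈ x ⁻¹ * y ⁻¹
  ⁻¹-distrib-* {x} {y} x≉0 y≉0 = sym (⁻¹-unique (*-nonzero x≉0 y≉0) (begin
    (x * y) * (x ⁻¹ * y ⁻¹)    ≈⟨ solve 4 (λ x y x′ y′ → (x :* y) :* (x′ :* y′) := (x :* x′) :* (y :* y′)) refl x y (x ⁻¹) (y ⁻¹) ⟩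
    (x * x ⁻¹) * (y * y ⁻¹)    ≈⟨ *-cong (inverseʳ x x≉0) (inverseʳ y y≉0) ⟩
    1# * 1#                    ≈⟨ *-identityˡ 1# ⟩
    1#                         ∎))

  1⁻¹≈1 : 1# ⁻¹ ≈ 1#
  1⁻¹≈1 = sym (⁻¹-unique 1≉0 (*-identityˡ 1#))

  ÷-distrib-* : ∀ x y {z w} → ¬ (z ≈ 0#) → ¬ (w ≈ 0#) → (x * y) ÷ (z * w) ≈ (x ÷ z) * (y ÷ w)
  ÷-distrib-* x y {z} {w} z≉0 w≉0 = begin
    (x * y) * (z * w) ⁻¹        ≈⟨ *-congˡ (⁻¹-distrib-* z≉0 w≉0) ⟩
    (x * y) * (z ⁻¹ * w ⁻¹)     ≈⟨ solve 4 (λ x y z′ w′ → (x :* y) :* (z′ :* w′) := (x :* z′) :* (y :* w′)) refl x y (z ⁻¹) (w ⁻¹) ⟩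
    (x * z ⁻¹) * (y * w ⁻¹)     ∎

  pow-nonzero : ∀ {x} n → ¬ (x ≈ 0#) → ¬ (pow x n ≈ 0#)
  pow-nonzero zero    x≉0 = 1≉0
  pow-nonzero (suc n) x≉0 = *-nonzero x≉0 (pow-nonzero n x≉0)

  pow-+ : ∀ x m n → pow x (m ℕ.+ n) ≈ pow x m * pow x n
  pow-+ x zero    n = sym (*-identityˡ (pow x n))
  pow-+ x (suc m) n = trans (*-congˡ (pow-+ x m n)) (sym (*-assoc x (pow x m) (pow x n)))

  pow-distrib-* : ∀ x y n → pow (x * y) n ≈ pow x n * pow y n
  pow-distrib-* x y zero    = sym (*-identityˡ 1#)
  pow-distrib-* x y (suc n) = begin
    (x * y) * pow (x * y) n      ≈⟨ *-congˡ (pow-distrib-* x y n) ⟩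
    (x * y) * (pow x n * pow y n) ≈⟨ solve 4 (λ x y a b → (x :* y) :* (a :* b) := (x :* a) :* (y :* b)) refl x y (pow x n) (pow y n) ⟩
    (x * pow x n) * (y * pow y n) ∎

  pow-double : ∀ x m → pow x (2 ℕ.* m) ≈ pow x m * pow x m
  pow-double x m = trans (pow-+ x m (m ℕ.+ 0)) (*-congˡ (reflexive (≡.cong (pow x) (ℕ.+-identityʳ m))))

  pow-triple : ∀ x m → pow x (3 ℕ.* m) ≈ pow x m * (pow x m * pow x m)
  pow-triple x m = trans (reflexive (≡.cong (pow x) (3*m≡m+[m+m] m))) (trans (pow-+ x m (m ℕ.+ m)) (*-congˡ (pow-+ x m m)))

  pow-inverse : ∀ {x y} → x * y ≈ 1# → ∀ n → pow x n * pow y n ≈ 1#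
  pow-inverse xy≈1 zero    = *-identityˡ 1#
  pow-inverse {x} {y} xy≈1 (suc n) = begin
    (x * pow x n) * (y * pow y n)   ≈⟨ solve 4 (λ x y a b → (x :* a) :* (y :* b) := (x :* y) :* (a :* b)) refl x y (pow x n) (pow y n) ⟩
    (x * y) * (pow x n * pow y n)   ≈⟨ *-cong xy≈1 (pow-inverse xy≈1 n) ⟩
    1# * 1#                         ≈⟨ *-identityˡ 1# ⟩
    1#                              ∎

  poch-congˡ : ∀ {x y} p m → x ≈ y → poch x p m ≈ poch y p m
  poch-congˡ p zero    x≈y = refl
  poch-congˡ p (suc m) x≈y = *-cong (poch-congˡ p m x≈y) (+-congˡ (-‿cong (*-congʳ x≈y)))

  sumTo-cong : ∀ n {f g : ℕ → Carrier} → (∀ j → j ≤ n → f j ≈ g j) → sumTo n f ≈ sumTo n g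
  sumTo-cong zero    f≈g = f≈g 0 z≤n
  sumTo-cong (suc n) f≈g = +-cong (sumTo-cong n (λ j j≤n → f≈g j (ℕ.m≤n⇒m≤1+n j≤n))) (f≈g (suc n) ℕ.≤-refl)

  sumTo-linear : ∀ n a b (f g : ℕ → Carrier) →
                 sumTo n (λ j → a * f j + b * g j) ≈ a * sumTo n f + b * sumTo n g
  sumTo-linear zero    a b f g = refl
  sumTo-linear (suc n) a b f g = begin
    sumTo n (λ j → a * f j + b * g j) + (a * f (suc n) + b * g (suc n))
      ≈⟨ +-congʳ (sumTo-linear n a b f g) ⟩
    (a * sumTo n f + b * sumTo n g) + (a * f (suc n) + b * g (suc n))
      ≈⟨ solve 6 (λ a b x y u v → (a :* x :+ b :* y) :+ (a :* u :+ b :* v) := a :* (x :+ u) :+ b :* (y :+ v)) refl a b (sumTo n f) (sumTo n g) (f (suc n)) (g (suc n)) ⟩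
    a * sumTo (suc n) f + b * sumTo (suc n) g ∎

  sumTo-telescope : ∀ n (f G : ℕ → Carrier) → f 0 ≈ G 0 →
                    (∀ i → suc i ≤ n → f (suc i) ≈ G (suc i) - G i) → sumTo n f ≈ G n
  sumTo-telescope zero    f G f0≈G0 step = f0≈G0
  sumTo-telescope (suc n) f G f0≈G0 step = begin
    sumTo n f + f (suc n)        ≈⟨ +-cong (sumTo-telescope n f G f0≈G0 (λ i i<n → step i (ℕ.m≤n⇒m≤1+n i<n))) (step n ℕ.≤-refl) ⟩
    G n + (G (suc n) - G n)      ≈⟨ solve 2 (λ x y → x :+ (y :- x) := y) refl (G n) (G (suc n)) ⟩
    G (suc n)                    ∎

module TelescopingIdentities {c ℓ : Level} (R : CommutativeRing c ℓ) where
  open CommutativeRing R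
  open IntegerCoefficientRingSolver R

  telescoping-identityA : ∀ k z y →
    z * (1# + y * y * y) + - (1# - k * (z * y) + k * ((z * y) * (z * y))) * (1# + y)
      ≈ (z - 1#) * (1# - k * (z * y * y)) - y * ((1# - k * z) * (1# - z * y * y))
  telescoping-identityA = solve 3 (λ k z y →
    z :* (:1 :+ y :* y :* y) :+ :- (:1 :- k :* (z :* y) :+ k :* ((z :* y) :* (z :* y))) :* (:1 :+ y)
      := (z :- :1) :* (:1 :- k :* (z :* y :* y)) :- y :* ((:1 :- k :* z) :* (:1 :- z :* y :* y))) refl

  telescoping-identityB : ∀ q k z y →
    (1# - q * (z * y)) * (q * (z * y)) * (1# - k * z) * (1# - k * (z * y * y)) * (1# + y)
      + (1# - k * (z * y)) * (1# - q * z) * (1# - q * (z * y * y)) * (1# + y)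
      ≈ (1# - k * (q * ((z * y) * (z * y)))) * ((1# - k * (z * y * y)) * (1# - q * z) + y * ((1# - k * z) * (1# - q * (z * y * y))))
  telescoping-identityB = solve 4 (λ q k z y →
    (:1 :- q :* (z :* y)) :* (q :* (z :* y)) :* (:1 :- k :* z) :* (:1 :- k :* (z :* y :* y)) :* (:1 :+ y)
      :+ (:1 :- k :* (z :* y)) :* (:1 :- q :* z) :* (:1 :- q :* (z :* y :* y)) :* (:1 :+ y)
      := (:1 :- k :* (q :* ((z :* y) :* (z :* y)))) :* ((:1 :- k :* (z :* y :* y)) :* (:1 :- q :* z) :+ y :* ((:1 :- k :* z) :* (:1 :- q :* (z :* y :* y))))) refl

module WPBaileyPair13 {c ℓ : Level} (F : Field c ℓ) (k s : Field.Carrier F)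
  (s≉0 : ¬ (Field._≈_ F s (Field.0# F)))
  (poch≉0 : ∀ m → ¬ (Field._≈_ F (FieldDefs.poch F (Field._*_ F s s) (Field._*_ F s s) m) (Field.0# F)))
  where
  open Field F
  open FieldDefs F
  open Pair13 F
  open FieldProperties F
  open TelescopingIdentities commutativeRing
  open import Algebra.Properties.Ring ring using (x[y-z]≈xy-xz)
  open import Algebra.Properties.Group +-group using (inverseˡ-unique)
  open IntegerCoefficientRingSolver commutativeRing
  open import Relation.Binary.Reasoning.Setoid setoid

  q t : Carrier
  q = s * s
  t = s ⁻¹

  A : ℕ → Carrier
  A m = poch k q m ÷ poch q q m

  K : ℕ → ℕ → Carrier
  K n j = A (n ∸ j) * A (n ℕ.+ j)

  bailey : (ℕ → Carrier) → ℕ → Carrier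
  bailey α n = sumTo n (λ j → K n j * α j)

  f : ℕ → Carrier
  f m = sgn m * pow t (m ℕ.* m ℕ.+ m)

  α₁ : ℕ → Carrier
  α₁ zero    = 1#
  α₁ (suc m) = f (suc m) * (1# + pow q (suc m))

  β₁ : ℕ → Carrier
  β₁ n = A n * f n

  Λ : ℕ → Carrier
  Λ n = 1# - k * pow q n + k * pow q (2 ℕ.* n)

  c₀ c₁ : ℕ → Carrier
  c₀ n = 1# - k * pow q n
  c₁ n = (1# - pow q (suc n)) * pow q (suc n)

  q≉0 : ¬ (q ≈ 0#)
  q≉0 = *-nonzero s≉0 s≉0

  1-q^suc≉0 : ∀ m → ¬ (1# - pow q (suc m) ≈ 0#)
  1-q^suc≉0 m = nonzero-factorʳ (poch≉0 (suc m))

  c₁≉0 : ∀ n → ¬ (c₁ n ≈ 0#)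
  c₁≉0 n = *-nonzero (1-q^suc≉0 n) (pow-nonzero (suc n) q≉0)

  A-suc : ∀ m → A (suc m) * (1# - pow q (suc m)) ≈ A m * (1# - k * pow q m)
  A-suc m = begin
    (P * (1# - k * pow q m)) * (Q * (1# - pow q (suc m))) ⁻¹ * (1# - pow q (suc m))
      ≈⟨ *-congʳ (*-congˡ (⁻¹-distrib-* (poch≉0 m) (1-q^suc≉0 m))) ⟩
    (P * (1# - k * pow q m)) * (Q ⁻¹ * E ⁻¹) * E
      ≈⟨ solve 5 (λ P a Q′ E′ E → (P :* a) :* (Q′ :* E′) :* E := (P :* Q′) :* a :* (E′ :* E)) refl P (1# - k * pow q m) (Q ⁻¹) (E ⁻¹) E ⟩
    (P * Q ⁻¹) * (1# - k * pow q m) * (E ⁻¹ * E)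
      ≈⟨ *-congˡ (inverseˡ E (1-q^suc≉0 m)) ⟩
    (P * Q ⁻¹) * (1# - k * pow q m) * 1#
      ≈⟨ *-identityʳ _ ⟩
    A m * (1# - k * pow q m) ∎
    where
    P = poch k q m
    Q = poch q q m
    E = 1# - pow q (suc m)

  A-zero : A 0 ≈ 1#
  A-zero = trans (*-identityˡ _) 1⁻¹≈1

  coefficient≈K : ∀ n j →
    (poch (k ÷ 1#) q (n ∸ j) * poch k q (n ℕ.+ j)) ÷ (poch q q (n ∸ j) * poch (1# * q) q (n ℕ.+ j)) ≈ K n j
  coefficient≈K n j = begin
    (poch (k ÷ 1#) q (n ∸ j) * poch k q (n ℕ.+ j)) ÷ (poch q q (n ∸ j) * poch (1# * q) q (n ℕ.+ j))
      ≈⟨ *-cong (*-congʳ (poch-congˡ q (n ∸ j) k÷1≈k)) (⁻¹-cong (*-congˡ (poch-congˡ q (n ℕ.+ j) (*-identityˡ q)))) ⟩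
    (poch k q (n ∸ j) * poch k q (n ℕ.+ j)) ÷ (poch q q (n ∸ j) * poch q q (n ℕ.+ j))
      ≈⟨ ÷-distrib-* (poch k q (n ∸ j)) (poch k q (n ℕ.+ j)) (poch≉0 (n ∸ j)) (poch≉0 (n ℕ.+ j)) ⟩
    K n j ∎
    where
    k÷1≈k : k ÷ 1# ≈ k
    k÷1≈k = trans (*-congˡ 1⁻¹≈1) (*-identityʳ k)

  s*t≈1 : s * t ≈ 1#
  s*t≈1 = inverseʳ s s≉0

  f-suc : ∀ m → f m ≈ - (pow q (suc m) * f (suc m))
  f-suc m = sym (begin
    - (pow q (suc m) * ((- 1# * sgn m) * pow t (suc m ℕ.* suc m ℕ.+ suc m)))
      ≈⟨ -‿cong (*-cong (pow-distrib-* s s (suc m)) (*-congˡ t-exponent)) ⟩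
    - ((a * a) * ((- 1# * sgn m) * (T * (b * b))))
      ≈⟨ solve 4 (λ a b g T → :- ((a :* a) :* ((:- :1 :* g) :* (T :* (b :* b)))) := (g :* T) :* ((a :* b) :* (a :* b))) refl a b (sgn m) T ⟩
    (sgn m * T) * ((a * b) * (a * b))
      ≈⟨ *-congˡ (*-cong ab≈1 ab≈1) ⟩
    (sgn m * T) * (1# * 1#)
      ≈⟨ solve 2 (λ g T → g :* T :* (:1 :* :1) := g :* T) refl (sgn m) T ⟩
    f m ∎)
    where
    a = pow s (suc m)
    b = pow t (suc m)
    T = pow t (m ℕ.* m ℕ.+ m)
    ab≈1 : a * b ≈ 1#
    ab≈1 = pow-inverse s*t≈1 (suc m)
    t-exponent : pow t (suc m ℕ.* suc m ℕ.+ suc m) ≈ T * (b * b)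
    t-exponent = begin
      pow t (suc m ℕ.* suc m ℕ.+ suc m)            ≡⟨ ≡.cong (pow t) ([1+m]*[1+m]+[1+m]≡[m*m+m]+[[1+m]+[1+m]] m) ⟩
      pow t ((m ℕ.* m ℕ.+ m) ℕ.+ (suc m ℕ.+ suc m)) ≈⟨ pow-+ t (m ℕ.* m ℕ.+ m) (suc m ℕ.+ suc m) ⟩
      T * pow t (suc m ℕ.+ suc m)                  ≈⟨ *-congˡ (pow-+ t (suc m) (suc m)) ⟩
      T * (b * b)                                  ∎

  α13-scaled : ∀ d m → let y = pow q (suc m) in
    pow q (d ℕ.+ suc m) * α13 s (suc m) ≈ f (suc m) * (pow q d * (1# + y * y * y))
  α13-scaled d m = begin
    pow q (d ℕ.+ j) * α13 s j
      ≈⟨ *-cong (trans (pow-+ q d j) (*-congˡ (pow-distrib-* s s j))) (*-congˡ (+-cong (pow-triple t j) (pow-triple s j))) ⟩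
    (z * (a * a)) * ((g * T) * (b * (b * b) + a * (a * a)))
      ≈⟨ solve 5 (λ z a b g T → (z :* (a :* a)) :* ((g :* T) :* (b :* (b :* b) :+ a :* (a :* a))) := (g :* T :* z) :* (b :* ((a :* b) :* (a :* b)) :+ a :* (a :* (a :* (a :* a))))) refl z a b g T ⟩
    (g * T * z) * (b * ((a * b) * (a * b)) + a⁵)
      ≈⟨ *-congˡ (+-congʳ (*-congˡ (*-cong ab≈1 ab≈1))) ⟩
    (g * T * z) * (b * (1# * 1#) + a⁵)
      ≈⟨ *-congˡ (+-congʳ (trans (*-congˡ (*-identityˡ 1#)) (*-identityʳ b))) ⟩
    (g * T * z) * (b + a⁵)
      ≈⟨ *-congˡ (+-congˡ (*-identityʳ a⁵)) ⟨
    (g * T * z) * (b + a⁵ * 1#)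
      ≈⟨ *-congˡ (+-congˡ (*-congˡ ab≈1)) ⟨
    (g * T * z) * (b + a⁵ * (a * b))
      ≈⟨ solve 5 (λ z a b g T → (g :* T :* z) :* (b :+ a :* (a :* (a :* (a :* a))) :* (a :* b)) := (g :* (T :* b)) :* (z :* (:1 :+ (a :* a) :* (a :* a) :* (a :* a)))) refl z a b g T ⟩
    (g * (T * b)) * (z * (1# + (a * a) * (a * a) * (a * a)))
      ≈⟨ *-cong (*-congˡ (pow-+ t (j ℕ.* j) j)) (*-congˡ (+-congˡ (*-cong (*-cong (pow-distrib-* s s j) (pow-distrib-* s s j)) (pow-distrib-* s s j)))) ⟨
    f j * (z * (1# + y * y * y)) ∎
    where
    j = suc m
    y = pow q j
    z = pow q d
    a = pow s j
    b = pow t j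
    g = sgn j
    T = pow t (j ℕ.* j)
    a⁵ = a * (a * (a * (a * a)))
    ab≈1 : a * b ≈ 1#
    ab≈1 = pow-inverse s*t≈1 j

  Λ-≈ : ∀ n {Q} → pow q n ≈ Q → Λ n ≈ 1# - k * Q + k * (Q * Q)
  Λ-≈ n q^n≈Q = +-cong (+-congˡ (-‿cong (*-congˡ q^n≈Q))) (*-congˡ (trans (pow-double q n) (*-cong q^n≈Q q^n≈Q)))

  1-k*-cong : ∀ {x y} → x ≈ y → 1# - k * x ≈ 1# - k * y
  1-k*-cong x≈y = +-congˡ (-‿cong (*-congˡ x≈y))

  1-q*-cong : ∀ {x y} → x ≈ y → 1# - q * x ≈ 1# - q * y
  1-q*-cong x≈y = +-congˡ (-‿cong (*-congˡ x≈y))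

  GA : ℕ → ℕ → Carrier
  GA n j = (pow q (n ∸ j) - 1#) * (1# - k * pow q (n ℕ.+ j)) * (K n j * f j)

  termA : ℕ → ℕ → Carrier
  termA n j = pow q n * (K n j * α13 s j) + (- Λ n) * (K n j * α₁ j)

  GB : ℕ → ℕ → Carrier
  GB n j = (1# - k * pow q (suc (n ℕ.+ n))) * (A (n ∸ j) * A (suc (n ℕ.+ j)) * f j)

  termB : ℕ → ℕ → Carrier
  termB n j = c₁ n * (K (suc n) j * α₁ j) + c₀ n * (K n j * α₁ j)

  module _ {n i : ℕ} (i<n : suc i ≤ n) where
    private
      j d : ℕ
      j = suc i
      d = n ∸ j

      z y : Carrier
      z = pow q d
      y = pow q j

      n≡d+j : n ≡ d ℕ.+ j
      n≡d+j = ≡.sym (ℕ.m∸n+n≡m i<n)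

      n∸i≡1+d : n ∸ i ≡ suc d
      n∸i≡1+d = ℕ.+-∸-assoc 1 i<n

      q^n≈zy : pow q n ≈ z * y
      q^n≈zy = trans (reflexive (≡.cong (pow q) n≡d+j)) (pow-+ q d j)

      q^[n+j]≈zyy : pow q (n ℕ.+ j) ≈ z * y * y
      q^[n+j]≈zyy = trans (pow-+ q n j) (*-congʳ q^n≈zy)

      GA-pred : GA n i ≈ (K n j * f j) * (y * ((1# - k * z) * (1# - z * y * y)))
      GA-pred = begin
        (pow q (n ∸ i) - 1#) * (1# - k * W) * (A (n ∸ i) * A (n ℕ.+ i) * f i)
          ≡⟨ ≡.cong (λ e → (pow q e - 1#) * (1# - k * W) * (A e * A (n ℕ.+ i) * f i)) n∸i≡1+d ⟩
        (pow q (suc d) - 1#) * (1# - k * W) * (A (suc d) * A (n ℕ.+ i) * f i)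
          ≈⟨ solve 5 (λ X W′ Ad An fi → (X :- :1) :* W′ :* (Ad :* An :* fi) := :- ((Ad :* (:1 :- X)) :* (An :* W′) :* fi)) refl (pow q (suc d)) (1# - k * W) (A (suc d)) (A (n ℕ.+ i)) (f i) ⟩
        - ((A (suc d) * (1# - pow q (suc d))) * (A (n ℕ.+ i) * (1# - k * W)) * f i)
          ≈⟨ -‿cong (*-cong (*-cong (A-suc d) (sym (A-suc (n ℕ.+ i)))) (f-suc i)) ⟩
        - ((A d * (1# - k * z)) * (A (suc (n ℕ.+ i)) * (1# - pow q (suc (n ℕ.+ i)))) * - (y * f j))
          ≡⟨ ≡.cong (λ e → - ((A d * (1# - k * z)) * (A e * (1# - pow q e)) * - (y * f j))) (≡.sym (ℕ.+-suc n i)) ⟩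
        - ((A d * (1# - k * z)) * (A (n ℕ.+ j) * (1# - pow q (n ℕ.+ j))) * - (y * f j))
          ≈⟨ -‿cong (*-congʳ (*-congˡ (*-congˡ (+-congˡ (-‿cong q^[n+j]≈zyy))))) ⟩
        - ((A d * (1# - k * z)) * (A (n ℕ.+ j) * (1# - z * y * y)) * - (y * f j))
          ≈⟨ solve 6 (λ Ad a An b y fj → :- ((Ad :* a) :* (An :* b) :* :- (y :* fj)) := (Ad :* An :* fj) :* (y :* (a :* b))) refl (A d) (1# - k * z) (A (n ℕ.+ j)) (1# - z * y * y) y (f j) ⟩
        (K n j * f j) * (y * ((1# - k * z) * (1# - z * y * y))) ∎
        where
        W = pow q (n ℕ.+ i)

    termA-suc : termA n j ≈ GA n j - GA n i
    termA-suc = begin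
      termA n j
        ≈⟨ +-cong scaled (*-congʳ (-‿cong (Λ-≈ n q^n≈zy))) ⟩
      K n j * (f j * (z * (1# + y * y * y))) + (- L) * (K n j * (f j * (1# + y)))
        ≈⟨ solve 5 (λ K f z y L → K :* (f :* (z :* (:1 :+ y :* y :* y))) :+ (:- L) :* (K :* (f :* (:1 :+ y))) := (K :* f) :* (z :* (:1 :+ y :* y :* y) :+ :- L :* (:1 :+ y))) refl (K n j) (f j) z y L ⟩
      Kf * (z * (1# + y * y * y) + - L * (1# + y))
        ≈⟨ *-congˡ (telescoping-identityA k z y) ⟩
      Kf * ((z - 1#) * (1# - k * (z * y * y)) - y * ((1# - k * z) * (1# - z * y * y)))
        ≈⟨ x[y-z]≈xy-xz Kf _ _ ⟩
      Kf * ((z - 1#) * (1# - k * (z * y * y))) - Kf * (y * ((1# - k * z) * (1# - z * y * y)))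
        ≈⟨ +-cong GA-j (-‿cong GA-pred) ⟨
      GA n j - GA n i ∎
      where
      Kf = K n j * f j
      L = 1# - k * (z * y) + k * ((z * y) * (z * y))
      scaled : pow q n * (K n j * α13 s j) ≈ K n j * (f j * (z * (1# + y * y * y)))
      scaled = begin
        pow q n * (K n j * α13 s j)          ≈⟨ solve 3 (λ x K a → x :* (K :* a) := K :* (x :* a)) refl (pow q n) (K n j) (α13 s j) ⟩
        K n j * (pow q n * α13 s j)          ≡⟨ ≡.cong (λ e → K n j * (pow q e * α13 s j)) n≡d+j ⟩
        K n j * (pow q (d ℕ.+ j) * α13 s j)  ≈⟨ *-congˡ (α13-scaled d i) ⟩
        K n j * (f j * (z * (1# + y * y * y))) ∎
      GA-j : GA n j ≈ Kf * ((z - 1#) * (1# - k * (z * y * y)))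
      GA-j = trans (*-congʳ (*-congˡ (1-k*-cong q^[n+j]≈zyy))) (*-comm _ Kf)

    private
      D₁ D₂ Kc Kc′ : Carrier
      D₁ = 1# - pow q (suc d)
      D₂ = 1# - pow q (suc (n ℕ.+ j))
      Kc = 1# - k * pow q (suc (n ℕ.+ n))
      Kc′ = 1# - k * (q * ((z * y) * (z * y)))

      GB-difference-scaled : D₁ * D₂ * (GB n j - GB n i) ≈
        (A d * A (n ℕ.+ j) * f j) * (Kc′ * ((1# - k * (z * y * y)) * (1# - q * z) + y * ((1# - k * z) * (1# - q * (z * y * y)))))
      GB-difference-scaled = begin
        D₁ * D₂ * (GB n j - GB n i)
          ≡⟨ ≡.cong₂ (λ e e′ → D₁ * D₂ * (GB n j - Kc * (A e * A e′ * f i))) n∸i≡1+d (≡.sym (ℕ.+-suc n i)) ⟩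
        D₁ * D₂ * (Kc * (A d * A (suc (n ℕ.+ j)) * f j) - Kc * (A (suc d) * A (n ℕ.+ j) * f i))
          ≈⟨ solve 9 (λ D₁ D₂ Kc Ad Asn fj Asd An fi → D₁ :* D₂ :* (Kc :* (Ad :* Asn :* fj) :- Kc :* (Asd :* An :* fi)) := Kc :* (Ad :* (Asn :* D₂) :* D₁ :* fj) :- Kc :* ((Asd :* D₁) :* An :* D₂ :* fi)) refl D₁ D₂ Kc (A d) (A (suc (n ℕ.+ j))) (f j) (A (suc d)) (A (n ℕ.+ j)) (f i) ⟩
        Kc * (A d * (A (suc (n ℕ.+ j)) * D₂) * D₁ * f j) - Kc * ((A (suc d) * D₁) * A (n ℕ.+ j) * D₂ * f i)
          ≈⟨ +-cong (*-congˡ (*-congʳ (*-congʳ (*-congˡ (A-suc (n ℕ.+ j)))))) (-‿cong (*-congˡ (*-cong (*-congʳ (*-congʳ (A-suc d))) (f-suc i)))) ⟩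
        Kc * (A d * (A (n ℕ.+ j) * (1# - k * W)) * D₁ * f j) - Kc * ((A d * (1# - k * z)) * A (n ℕ.+ j) * D₂ * - (y * f j))
          ≈⟨ solve 9 (λ Kc Ad An fj y a b D₁ D₂ → Kc :* (Ad :* (An :* b) :* D₁ :* fj) :- Kc :* ((Ad :* a) :* An :* D₂ :* :- (y :* fj)) := (Ad :* An :* fj) :* (Kc :* (b :* D₁ :+ y :* (a :* D₂)))) refl Kc (A d) (A (n ℕ.+ j)) (f j) y (1# - k * z) (1# - k * W) D₁ D₂ ⟩
        (A d * A (n ℕ.+ j) * f j) * (Kc * ((1# - k * W) * D₁ + y * ((1# - k * z) * D₂)))
          ≈⟨ *-congˡ (*-cong Kc≈ (+-cong (*-congʳ (1-k*-cong q^[n+j]≈zyy)) (*-congˡ (*-congˡ D₂≈)))) ⟩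
        (A d * A (n ℕ.+ j) * f j) * (Kc′ * ((1# - k * (z * y * y)) * (1# - q * z) + y * ((1# - k * z) * (1# - q * (z * y * y))))) ∎
        where
        W = pow q (n ℕ.+ j)
        Kc≈ : Kc ≈ Kc′
        Kc≈ = 1-k*-cong (*-congˡ (trans (pow-+ q n n) (*-cong q^n≈zy q^n≈zy)))
        D₂≈ : D₂ ≈ 1# - q * (z * y * y)
        D₂≈ = +-congˡ (-‿cong (*-congˡ q^[n+j]≈zyy))

    -- Multiplying by D₁ * D₂ clears the denominators of A (suc d) and A (suc (n + j)).
    termB-suc : termB n j ≈ GB n j - GB n i
    termB-suc = *-cancelˡ (*-nonzero (1-q^suc≉0 d) (1-q^suc≉0 (n ℕ.+ j))) (begin
      D₁ * D₂ * termB n j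
        ≡⟨ ≡.cong (λ e → D₁ * D₂ * (c₁ n * (A e * A (suc (n ℕ.+ j)) * Φ) + c₀ n * (K n j * Φ))) n∸i≡1+d ⟩
      D₁ * D₂ * (c₁ n * (A (suc d) * A (suc (n ℕ.+ j)) * Φ) + c₀ n * (A d * A (n ℕ.+ j) * Φ))
        ≈⟨ solve 9 (λ D₁ D₂ c₁ c₀ Asd Asn Ad An Φ → D₁ :* D₂ :* (c₁ :* (Asd :* Asn :* Φ) :+ c₀ :* (Ad :* An :* Φ)) := c₁ :* (Asd :* D₁) :* (Asn :* D₂) :* Φ :+ c₀ :* D₁ :* D₂ :* (Ad :* An) :* Φ) refl D₁ D₂ (c₁ n) (c₀ n) (A (suc d)) (A (suc (n ℕ.+ j))) (A d) (A (n ℕ.+ j)) Φ ⟩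
      c₁ n * (A (suc d) * D₁) * (A (suc (n ℕ.+ j)) * D₂) * Φ + c₀ n * D₁ * D₂ * (A d * A (n ℕ.+ j)) * Φ
        ≈⟨ +-congʳ (*-congʳ (*-cong (*-congˡ (A-suc d)) (A-suc (n ℕ.+ j)))) ⟩
      c₁ n * (A d * (1# - k * z)) * (A (n ℕ.+ j) * (1# - k * W)) * Φ + c₀ n * D₁ * D₂ * (A d * A (n ℕ.+ j)) * Φ
        ≈⟨ solve 10 (λ c₁ c₀ Ad An fj y a b D₁ D₂ → c₁ :* (Ad :* a) :* (An :* b) :* (fj :* (:1 :+ y)) :+ c₀ :* D₁ :* D₂ :* (Ad :* An) :* (fj :* (:1 :+ y)) := (Ad :* An :* fj) :* (c₁ :* a :* b :* (:1 :+ y) :+ c₀ :* D₁ :* D₂ :* (:1 :+ y))) refl (c₁ n) (c₀ n) (A d) (A (n ℕ.+ j)) (f j) y (1# - k * z) (1# - k * W) D₁ D₂ ⟩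
      B * (c₁ n * (1# - k * z) * (1# - k * W) * (1# + y) + c₀ n * D₁ * D₂ * (1# + y))
        ≈⟨ *-congˡ (+-cong (*-congʳ (*-cong (*-congʳ c₁≈) (1-k*-cong q^[n+j]≈zyy))) (*-congʳ (*-cong (*-congʳ (1-k*-cong q^n≈zy)) (1-q*-cong q^[n+j]≈zyy)))) ⟩
      B * ((1# - q * (z * y)) * (q * (z * y)) * (1# - k * z) * (1# - k * (z * y * y)) * (1# + y) + (1# - k * (z * y)) * (1# - q * z) * (1# - q * (z * y * y)) * (1# + y))
        ≈⟨ *-congˡ (telescoping-identityB q k z y) ⟩
      B * (Kc′ * ((1# - k * (z * y * y)) * (1# - q * z) + y * ((1# - k * z) * (1# - q * (z * y * y)))))
        ≈⟨ GB-difference-scaled ⟨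
      D₁ * D₂ * (GB n j - GB n i) ∎)
      where
      W = pow q (n ℕ.+ j)
      Φ = f j * (1# + y)
      B = A d * A (n ℕ.+ j) * f j
      c₁≈ : c₁ n ≈ (1# - q * (z * y)) * (q * (z * y))
      c₁≈ = *-cong (1-q*-cong q^n≈zy) (*-congˡ q^n≈zy)

  termA-zero : ∀ n → termA n 0 ≈ GA n 0
  termA-zero n = begin
    pow q n * (K n 0 * 1#) + (- Λ n) * (K n 0 * 1#)
      ≈⟨ +-congˡ (*-congʳ (-‿cong (Λ-≈ n refl))) ⟩
    Q * (K n 0 * 1#) + (- (1# - k * Q + k * (Q * Q))) * (K n 0 * 1#)
      ≈⟨ solve 3 (λ Q k κ → Q :* (κ :* :1) :+ (:- (:1 :- k :* Q :+ k :* (Q :* Q))) :* (κ :* :1) := (Q :- :1) :* (:1 :- k :* Q) :* (κ :* (:1 :* :1))) refl Q k (K n 0) ⟩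
    (Q - 1#) * (1# - k * Q) * (K n 0 * (1# * 1#))
      ≡⟨ ≡.cong (λ e → (Q - 1#) * (1# - k * pow q e) * (K n 0 * (1# * 1#))) (≡.sym (ℕ.+-identityʳ n)) ⟩
    GA n 0 ∎
    where
    Q = pow q n

  GA-diagonal : ∀ n → GA n n ≈ 0#
  GA-diagonal n = begin
    (pow q (n ∸ n) - 1#) * (1# - k * pow q (n ℕ.+ n)) * (K n n * f n)
      ≡⟨ ≡.cong (λ e → (pow q e - 1#) * (1# - k * pow q (n ℕ.+ n)) * (K n n * f n)) (ℕ.n∸n≡0 n) ⟩
    (1# - 1#) * (1# - k * pow q (n ℕ.+ n)) * (K n n * f n)
      ≈⟨ solve 2 (λ x y → (:1 :- :1) :* x :* y := :0) refl (1# - k * pow q (n ℕ.+ n)) (K n n * f n) ⟩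
    0# ∎

  bailey-α13-scaled : ∀ n → pow q n * bailey (α13 s) n ≈ Λ n * bailey α₁ n
  bailey-α13-scaled n = begin
    pow q n * bailey (α13 s) n      ≈⟨ inverseˡ-unique _ _ telescoped ⟩
    - (- Λ n * bailey α₁ n)         ≈⟨ solve 2 (λ L B → :- (:- L :* B) := L :* B) refl (Λ n) (bailey α₁ n) ⟩
    Λ n * bailey α₁ n               ∎
    where
    telescoped : pow q n * bailey (α13 s) n + (- Λ n) * bailey α₁ n ≈ 0#
    telescoped = begin
      pow q n * bailey (α13 s) n + (- Λ n) * bailey α₁ n  ≈⟨ sumTo-linear n (pow q n) (- Λ n) _ _ ⟨
      sumTo n (termA n)   ≈⟨ sumTo-telescope n (termA n) (GA n) (termA-zero n) (λ i → termA-suc) ⟩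
      GA n n              ≈⟨ GA-diagonal n ⟩
      0#                  ∎

  termB-zero : ∀ n → termB n 0 ≈ GB n 0
  termB-zero n = *-cancelˡ (1-q^suc≉0 n) (begin
    D * termB n 0
      ≡⟨ ≡.cong (λ e → D * (c₁ n * (A (suc n) * A (suc e) * 1#) + c₀ n * (A n * A e * 1#))) (ℕ.+-identityʳ n) ⟩
    D * (c₁ n * (A (suc n) * A (suc n) * 1#) + c₀ n * (A n * A n * 1#))
      ≈⟨ solve 4 (λ X c₀ A₁ A₀ → (:1 :- X) :* ((:1 :- X) :* X :* (A₁ :* A₁ :* :1) :+ c₀ :* (A₀ :* A₀ :* :1)) := X :* (A₁ :* (:1 :- X)) :* (A₁ :* (:1 :- X)) :+ c₀ :* (A₀ :* A₀) :* (:1 :- X)) refl X (c₀ n) (A (suc n)) (A n) ⟩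
    X * (A (suc n) * D) * (A (suc n) * D) + c₀ n * (A n * A n) * D
      ≈⟨ +-congʳ (*-cong (*-congˡ (A-suc n)) (A-suc n)) ⟩
    X * (A n * c₀ n) * (A n * c₀ n) + c₀ n * (A n * A n) * D
      ≈⟨ solve 4 (λ X Q k A₀ → X :* (A₀ :* (:1 :- k :* Q)) :* (A₀ :* (:1 :- k :* Q)) :+ (:1 :- k :* Q) :* (A₀ :* A₀) :* (:1 :- X) := (:1 :- k :* (X :* Q)) :* (A₀ :* (A₀ :* (:1 :- k :* Q)))) refl X Q k (A n) ⟩
    (1# - k * (X * Q)) * (A n * (A n * c₀ n))
      ≈⟨ *-cong (1-k*-cong (trans (*-congˡ (pow-+ q n n)) (sym (*-assoc q Q Q)))) (*-congˡ (A-suc n)) ⟨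
    (1# - k * pow q (suc (n ℕ.+ n))) * (A n * (A (suc n) * D))
      ≈⟨ solve 4 (λ D Kc A₀ A₁ → Kc :* (A₀ :* (A₁ :* D)) := D :* (Kc :* (A₀ :* A₁ :* (:1 :* :1)))) refl D (1# - k * pow q (suc (n ℕ.+ n))) (A n) (A (suc n)) ⟩
    D * ((1# - k * pow q (suc (n ℕ.+ n))) * (A n * A (suc n) * (1# * 1#)))
      ≡⟨ ≡.cong (λ e → D * ((1# - k * pow q (suc (n ℕ.+ n))) * (A n * A (suc e) * (1# * 1#)))) (≡.sym (ℕ.+-identityʳ n)) ⟩
    D * GB n 0 ∎)
    where
    Q = pow q n
    X = pow q (suc n)
    D = 1# - X

  termB-last : ∀ n → c₁ n * (K (suc n) (suc n) * α₁ (suc n)) ≈ - GB n n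
  termB-last n = begin
    c₁ n * (A (n ∸ n) * A (suc (n ℕ.+ suc n)) * (f (suc n) * (1# + Y)))
      ≡⟨ ≡.cong (λ e → c₁ n * (A (n ∸ n) * A (suc e) * (f (suc n) * (1# + Y)))) (ℕ.+-suc n n) ⟩
    c₁ n * (A (n ∸ n) * A (suc M) * (f (suc n) * (1# + Y)))
      ≈⟨ solve 4 (λ Y A₀ A f → (:1 :- Y) :* Y :* (A₀ :* A :* (f :* (:1 :+ Y))) := Y :* A₀ :* (A :* (:1 :- Y :* Y)) :* f) refl Y (A (n ∸ n)) (A (suc M)) (f (suc n)) ⟩
    Y * A (n ∸ n) * (A (suc M) * (1# - Y * Y)) * f (suc n)
      ≈⟨ *-congʳ (*-congˡ (*-congˡ (+-congˡ (-‿cong Y²≈)))) ⟩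
    Y * A (n ∸ n) * (A (suc M) * (1# - pow q (suc M))) * f (suc n)
      ≈⟨ *-congʳ (*-congˡ (A-suc M)) ⟩
    Y * A (n ∸ n) * (A M * (1# - k * pow q M)) * f (suc n)
      ≈⟨ solve 5 (λ Y A₀ A Kc f → Y :* A₀ :* (A :* Kc) :* f := :- (Kc :* (A₀ :* A :* :- (Y :* f)))) refl Y (A (n ∸ n)) (A M) (1# - k * pow q M) (f (suc n)) ⟩
    - ((1# - k * pow q M) * (A (n ∸ n) * A M * - (Y * f (suc n))))
      ≈⟨ -‿cong (*-congˡ (*-congˡ (f-suc n))) ⟨
    - GB n n ∎
    where
    M = suc (n ℕ.+ n)
    Y = pow q (suc n)
    Y²≈ : Y * Y ≈ pow q (suc M)
    Y²≈ = sym (trans (reflexive (≡.cong (λ e → pow q (suc e)) (≡.sym (ℕ.+-suc n n)))) (pow-+ q (suc n) (suc n)))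

  bailey-α₁-recurrence : ∀ n → c₁ n * bailey α₁ (suc n) + c₀ n * bailey α₁ n ≈ 0#
  bailey-α₁-recurrence n = begin
    c₁ n * (init + last) + c₀ n * bailey α₁ n
      ≈⟨ solve 5 (λ a b I l S → a :* (I :+ l) :+ b :* S := (a :* I :+ b :* S) :+ a :* l) refl (c₁ n) (c₀ n) init last (bailey α₁ n) ⟩
    (c₁ n * init + c₀ n * bailey α₁ n) + c₁ n * last
      ≈⟨ +-cong (sym (sumTo-linear n (c₁ n) (c₀ n) _ _)) (termB-last n) ⟩
    sumTo n (termB n) + - GB n n
      ≈⟨ +-congʳ (sumTo-telescope n (termB n) (GB n) (termB-zero n) (λ i → termB-suc)) ⟩
    GB n n - GB n n
      ≈⟨ -‿inverseʳ (GB n n) ⟩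
    0# ∎
    where
    init = sumTo n (λ j → K (suc n) j * α₁ j)
    last = K (suc n) (suc n) * α₁ (suc n)

  β₁-recurrence : ∀ n → c₁ n * β₁ (suc n) + c₀ n * β₁ n ≈ 0#
  β₁-recurrence n = begin
    c₁ n * (A (suc n) * f (suc n)) + c₀ n * (A n * f n)
      ≈⟨ solve 5 (λ Y A₁ f₁ c₀ X → (:1 :- Y) :* Y :* (A₁ :* f₁) :+ c₀ :* X := Y :* (A₁ :* (:1 :- Y)) :* f₁ :+ c₀ :* X) refl Y (A (suc n)) (f (suc n)) (c₀ n) (A n * f n) ⟩
    Y * (A (suc n) * (1# - Y)) * f (suc n) + c₀ n * (A n * f n)
      ≈⟨ +-cong (*-congʳ (*-congˡ (A-suc n))) (*-congˡ (*-congˡ (f-suc n))) ⟩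
    Y * (A n * c₀ n) * f (suc n) + c₀ n * (A n * - (Y * f (suc n)))
      ≈⟨ solve 4 (λ Y A c f → Y :* (A :* c) :* f :+ c :* (A :* :- (Y :* f)) := :0) refl Y (A n) (c₀ n) (f (suc n)) ⟩
    0# ∎
    where
    Y = pow q (suc n)

  bailey-α₁≈β₁ : ∀ n → bailey α₁ n ≈ β₁ n
  bailey-α₁≈β₁ zero = begin
    A 0 * A 0 * 1#     ≈⟨ *-congʳ (*-congʳ A-zero) ⟩
    1# * A 0 * 1#      ≈⟨ solve 1 (λ a → :1 :* a :* :1 := a :* (:1 :* :1)) refl (A 0) ⟩
    A 0 * (1# * 1#)    ∎
  bailey-α₁≈β₁ (suc n) = *-cancelˡ (c₁≉0 n) (begin
    c₁ n * bailey α₁ (suc n)  ≈⟨ inverseˡ-unique _ _ (bailey-α₁-recurrence n) ⟩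
    - (c₀ n * bailey α₁ n)    ≈⟨ -‿cong (*-congˡ (bailey-α₁≈β₁ n)) ⟩
    - (c₀ n * β₁ n)           ≈⟨ inverseˡ-unique _ _ (β₁-recurrence n) ⟨
    c₁ n * β₁ (suc n)         ∎)

  β13-scaled : ∀ n → pow q n * β13 k s n ≈ Λ n * β₁ n
  β13-scaled n = begin
    pow q n * ((g * Λ n * Pk) * (pow s m * Pq) ⁻¹)
      ≈⟨ *-cong (pow-distrib-* s s n) (*-congˡ (⁻¹-distrib-* (pow-nonzero m s≉0) (poch≉0 n))) ⟩
    (a * a) * ((g * Λ n * Pk) * ((pow s m) ⁻¹ * Pq ⁻¹))
      ≈⟨ *-congˡ (*-congˡ (*-congʳ (sym s^m⁻¹≈))) ⟩
    (a * a) * ((g * Λ n * Pk) * ((T * (b * b)) * Pq ⁻¹))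
      ≈⟨ solve 7 (λ a b g L Pk Pq′ T → (a :* a) :* ((g :* L :* Pk) :* ((T :* (b :* b)) :* Pq′)) := L :* ((Pk :* Pq′) :* (g :* T)) :* ((a :* b) :* (a :* b))) refl a b g (Λ n) Pk (Pq ⁻¹) T ⟩
    Λ n * β₁ n * ((a * b) * (a * b))
      ≈⟨ *-congˡ (*-cong ab≈1 ab≈1) ⟩
    Λ n * β₁ n * (1# * 1#)
      ≈⟨ trans (*-congˡ (*-identityˡ 1#)) (*-identityʳ _) ⟩
    Λ n * β₁ n ∎
    where
    m = n ℕ.* n ℕ.+ 3 ℕ.* n
    g = sgn n
    Pk = poch k q n
    Pq = poch q q n
    a = pow s n
    b = pow t n
    T = pow t (n ℕ.* n ℕ.+ n)
    ab≈1 : a * b ≈ 1#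
    ab≈1 = pow-inverse s*t≈1 n
    s^m⁻¹≈ : T * (b * b) ≈ (pow s m) ⁻¹
    s^m⁻¹≈ = begin
      T * (b * b)                  ≈⟨ *-congˡ (pow-+ t n n) ⟨
      T * pow t (n ℕ.+ n)          ≈⟨ pow-+ t (n ℕ.* n ℕ.+ n) (n ℕ.+ n) ⟨
      pow t (n ℕ.* n ℕ.+ n ℕ.+ (n ℕ.+ n)) ≡⟨ ≡.cong (pow t) (m*m+3*m≡[m*m+m]+[m+m] n) ⟨
      pow t m                      ≈⟨ ⁻¹-unique (pow-nonzero m s≉0) (pow-inverse s*t≈1 m) ⟩
      (pow s m) ⁻¹                 ∎

  bailey-α13≈β13 : ∀ n → bailey (α13 s) n ≈ β13 k s n
  bailey-α13≈β13 n = *-cancelˡ (pow-nonzero n q≉0) (begin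
    pow q n * bailey (α13 s) n  ≈⟨ bailey-α13-scaled n ⟩
    Λ n * bailey α₁ n           ≈⟨ *-congˡ (bailey-α₁≈β₁ n) ⟩
    Λ n * β₁ n                  ≈⟨ β13-scaled n ⟨
    pow q n * β13 k s n         ∎)

mainTheorem13 : {c ℓ : Level} (F : Field c ℓ) (k s : Field.Carrier F)
    → ¬ (Field._≈_ F s (Field.0# F))
    → (∀ (m : ℕ) → ¬ (Field._≈_ F (FieldDefs.poch F (Field._*_ F s s) (Field._*_ F s s) m) (Field.0# F)))
    → FieldDefs.IsWPBaileyPair F (Field._*_ F s s) (Field.1# F) k (Pair13.α13 F s) (Pair13.β13 F k s)
mainTheorem13 F k s s≉0 poch≉0 = refl , λ n → sym (trans (sumTo-cong n (λ j _ → *-congʳ (coefficient≈K n j))) (bailey-α13≈β13 n))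
  where
  open Field F using (refl; sym; trans; *-congʳ)
  open FieldProperties F using (sumTo-cong)
  open WPBaileyPair13 F k s s≉0 poch≉0
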